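{- Let $u$ be a vertex of a graph $G=(V,E)$. Then $u$ is avoidable in $G$ if and only if $x$ protects $u$ for every vertex $x\in N_G(u)$.
   Context: All graphs are finite, simple and undirected. A vertex $v$ of a graph $G$ is avoidable if every induced path on three vertices with middle vertex $v$ is contained in an induced cycle of $G$. For $S\subseteq V(G)$, an $S$-excluded path is a path none of whose internal vertices belongs to $S$ (an edge is an $S$-excluded path for every $S$, and a single vertex is joined to itself by the trivial path). For vertices $x,y$ of $G$, $x$ protects $y$ if there is an $N_G[y]$-excluded path between $x$ and every vertex of $N_G(y)$; i.e., for any $z\in N_G(y)\setminus\{x\}$, either $xz\in E(G)$ or $x$ can reach $z$ through vertices of $V(G)\setminus N_G[y]$. -}

module Defs where

open import Data.Nat using (ℕ)
open import Data.Fin using (Fin)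
open import Data.Bool using (Bool; T)
open import Data.List using (List; []; _∷_; _++_; _∷ʳ_)
open import Data.List.Membership.Propositional using (_∈_)
open import Data.List.Relation.Unary.All using (All)
open import Data.List.Relation.Unary.Linked using (Linked)
open import Data.List.Relation.Unary.Unique.Propositional using (Unique)
open import Data.Product using (Σ; ∃; _×_; _,_)
open import Data.Sum using (_⊎_)
open import Relation.Binary.PropositionalEquality using (_≡_; _≢_)
open import Relation.Nullary using (¬_)

record Graph (n : ℕ) : Set where
  field
    adj    : Fin n → Fin n → Bool
    sym    : ∀ x y → T (adj x y) → T (adj y x)
    irrefl : ∀ x → ¬ T (adj x x)

module _ {n : ℕ} (G : Graph n) where
  open Graph G

  Vertex : Set
  Vertex = Fin n

  E : Vertex → Vertex → Set
  E x y = T (adj x y)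

  N : Vertex → Vertex → Set
  N y w = E y w

  N[_] : Vertex → Vertex → Set
  N[ y ] w = w ≡ y ⊎ E y w

  InducedP3 : Vertex → Vertex → Vertex → Set
  InducedP3 a v b = E a v × E v b × a ≢ b × ¬ E a b

  Consecutive : List Vertex → Vertex → Vertex → Set
  Consecutive c x y = ∃ λ xs → ∃ λ ys → c ≡ xs ++ x ∷ y ∷ ys

  CycleAdj : List Vertex → Vertex → Vertex → Set
  CycleAdj c x y =
      Consecutive c x y
    ⊎ Consecutive c y x
    ⊎ (∃ λ mid → c ≡ x ∷ mid ∷ʳ y)
    ⊎ (∃ λ mid → c ≡ y ∷ mid ∷ʳ x)

  -- an induced cycle, given by its cyclic vertex sequence c = c₀ c₁ … c_{k-1}:
  -- at least three distinct vertices, and two vertices of c are adjacent in G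
  -- exactly when they are consecutive in the cyclic order.
  record InducedCycle (c : List Vertex) : Set where
    field
      atLeast3 : ∃ λ x → ∃ λ y → ∃ λ z → ∃ λ rest → c ≡ x ∷ y ∷ z ∷ rest
      distinct : Unique c
      cycEdges : ∀ x y → x ∈ c → y ∈ c → CycleAdj c x y → E x y
      induced  : ∀ x y → x ∈ c → y ∈ c → E x y → CycleAdj c x y

  P3InCycle : Vertex → Vertex → Vertex → List Vertex → Set
  P3InCycle a v b c = a ∈ c × v ∈ c × b ∈ c × CycleAdj c a v × CycleAdj c v b

  Avoidable : Vertex → Set
  Avoidable v = ∀ a b → InducedP3 a v b →
    ∃ λ c → InducedCycle c × P3InCycle a v b c

  ExcludedPath : (Vertex → Set) → Vertex → Vertex → Set
  ExcludedPath S x z =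
      x ≡ z
    ⊎ (∃ λ mid → Unique (x ∷ mid ∷ʳ z) × Linked E (x ∷ mid ∷ʳ z)
                × All (λ w → ¬ S w) mid)

  Protects : Vertex → Vertex → Set
  Protects x y = ∀ z → N y z → ExcludedPath N[ y ] x z

-- Deleting u from an induced cycle through a - u - b leaves a path from a to b
-- whose internal vertices avoid N[u], since a and b are the only neighbours of u
-- on the cycle.  Conversely, an N[u]-excluded path from a to b can be shortcut to
-- a chordless one, and closing it up through u gives an induced cycle.
module Submission where

open import Defs
open import Data.Nat using (ℕ)
open import Data.Fin using (_≟_)
open import Data.Empty using (⊥-elim)
open import Data.List using (List; []; _∷_; _++_; _∷ʳ_; [_]; reverse; reverseAcc)
open import Data.List.Properties using (++-identityʳ; ++-assoc; ∷-injective; ∷ʳ-injectiveʳ; reverse-++; unfold-reverse)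
open import Data.List.Membership.Propositional using (_∈_; _∉_)
open import Data.List.Membership.Propositional.Properties using (∈-++⁺ˡ; ∈-++⁺ʳ; ∈-++⁻; ∈-∃++)
open import Data.List.Relation.Unary.Any using (here; there)
open import Data.List.Relation.Unary.All as All using (All; []; _∷_)
open import Data.List.Relation.Unary.All.Properties using (¬Any⇒All¬)
open import Data.List.Relation.Unary.Linked as Linked using (Linked; []; [-]; _∷_)
open import Data.List.Relation.Unary.Unique.Propositional as UniqueList using (Unique; []; _∷_)
open import Data.List.Relation.Unary.Unique.Propositional.Properties using (Unique[x∷xs]⇒x∉xs)
open import Data.List.Relation.Binary.Sublist.Propositional using (_⊆_; []; _∷_; ⊆-refl; ⊆-trans; lookup) renaming (_∷ʳ_ to _∷ʳ⊆_)
open import Data.List.Relation.Binary.Sublist.Propositional.Properties using (All-resp-⊆)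
open import Data.List.Relation.Binary.Permutation.Propositional using (_↭_; ↭-sym; ↭⇒↭ₛ)
open import Data.List.Relation.Binary.Permutation.Propositional.Properties using (++-comm; ↭-reverse; All-resp-↭; ∈-resp-↭)
import Data.List.Relation.Binary.Permutation.Setoid.Properties as PermutationSetoid
open import Data.Product using (∃; ∃₂; _×_; _,_; proj₁; proj₂; map₂)
open import Function.Base using (_∘_)
open import Data.Sum using (_⊎_; inj₁; inj₂)
open import Function.Bundles using (_⇔_; mk⇔)
open import Relation.Binary.Definitions using (Decidable; Symmetric)
open import Relation.Binary.PropositionalEquality using (_≡_; _≢_; refl; sym; trans; cong; subst; setoid)
open import Relation.Nullary using (¬_; yes; no)
open import Relation.Nullary.Decidable using (T?)

module _ {A : Set} where

  AtLeastThree : List A → Set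
  AtLeastThree c = ∃ λ x → ∃ λ y → ∃ λ z → ∃ λ rest → c ≡ x ∷ y ∷ z ∷ rest

  EndOf : List A → A → Set
  EndOf l w = (∃ λ t → l ≡ w ∷ t) ⊎ (∃ λ t → l ≡ t ∷ʳ w)

  ∷ʳ-nonempty : ∀ (xs : List A) x → ∃₂ λ h t → xs ∷ʳ x ≡ h ∷ t
  ∷ʳ-nonempty []       x = x , [] , refl
  ∷ʳ-nonempty (h ∷ xs) x = h , xs ∷ʳ x , refl

  AtLeastThree-rotate : ∀ {x xs} → AtLeastThree (x ∷ xs) → AtLeastThree (xs ∷ʳ x)
  AtLeastThree-rotate (x , y , z , rest , refl) with ∷ʳ-nonempty rest x
  ... | w , t , eq = y , z , w , t , cong (λ r → y ∷ z ∷ r) eq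

  rotate-++ : (P : List A → Set) → (∀ {x xs} → P (x ∷ xs) → P (xs ∷ʳ x)) →
              ∀ xs {ys} → P (xs ++ ys) → P (ys ++ xs)
  rotate-++ P step []       {ys} p = subst P (sym (++-identityʳ ys)) p
  rotate-++ P step (x ∷ xs) {ys} p =
    subst P (++-assoc ys [ x ] xs)
      (rotate-++ P step xs (subst P (++-assoc xs ys [ x ]) (step p)))

  ∈-∷ʳ⁻ : ∀ {y b : A} xs → y ∈ xs ∷ʳ b → y ∈ xs ⊎ y ≡ b
  ∈-∷ʳ⁻ xs m with ∈-++⁻ xs m
  ... | inj₁ m′         = inj₁ m′
  ... | inj₂ (here y≡b) = inj₂ y≡b

  Unique-resp-↭ : ∀ {xs ys : List A} → xs ↭ ys → Unique xs → Unique ys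
  Unique-resp-↭ p = PermutationSetoid.Unique-resp-↭ (setoid A) (↭⇒↭ₛ p)

  Unique-resp-⊇ : ∀ {xs ys : List A} → xs ⊆ ys → Unique ys → Unique xs
  Unique-resp-⊇ []           []      = []
  Unique-resp-⊇ (_ ∷ʳ⊆ sub)  (_ ∷ u) = Unique-resp-⊇ sub u
  Unique-resp-⊇ (refl ∷ sub) (a ∷ u) = All-resp-⊆ sub a ∷ Unique-resp-⊇ sub u

  reverse-∷-∷ʳ : ∀ (x : A) mid z → reverse (x ∷ mid ∷ʳ z) ≡ z ∷ reverse mid ∷ʳ x
  reverse-∷-∷ʳ x mid z = trans (reverse-++ (x ∷ mid) [ z ]) (cong (z ∷_) (unfold-reverse x mid))

  head-last : ∀ {x z : A} {t t′} → x ≢ z → x ∷ t ≡ t′ ∷ʳ z → ∃ λ mid → t ≡ mid ∷ʳ z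
  head-last {t′ = []}    x≢z refl = ⊥-elim (x≢z refl)
  head-last {t′ = _ ∷ m} _   refl = m , refl

  EndOf-distinct : ∀ {l x z} → EndOf l x → EndOf l z → x ≢ z →
                   (∃ λ mid → l ≡ x ∷ mid ∷ʳ z) ⊎ (∃ λ mid → l ≡ z ∷ mid ∷ʳ x)
  EndOf-distinct (inj₁ (_ , refl)) (inj₁ (_ , eq)) x≢z = ⊥-elim (x≢z (proj₁ (∷-injective eq)))
  EndOf-distinct (inj₂ (t , refl)) (inj₂ (t′ , eq)) x≢z = ⊥-elim (x≢z (∷ʳ-injectiveʳ t t′ eq))
  EndOf-distinct {x = x} (inj₁ (_ , refl)) (inj₂ (_ , eq)) x≢z =
    inj₁ (map₂ (cong (x ∷_)) (head-last x≢z eq))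
  EndOf-distinct {z = z} (inj₂ (_ , refl)) (inj₁ (_ , eq)) x≢z =
    inj₂ (map₂ (λ e → trans eq (cong (z ∷_) e)) (head-last (x≢z ∘ sym) (sym eq)))

  EndOf-∉-interior : ∀ {x mid z w} → Unique (x ∷ mid ∷ʳ z) → EndOf (x ∷ mid ∷ʳ z) w → w ∉ mid
  EndOf-∉-interior (x∉ ∷ _) (inj₁ (_ , eq)) w∈ with ∷-injective eq
  ... | refl , _ = All.lookup x∉ (∈-++⁺ˡ w∈) refl
  EndOf-∉-interior {x} {mid} (_ ∷ u) (inj₂ (t , eq)) w∈ with ∷ʳ-injectiveʳ (x ∷ mid) t eq
  ... | refl = Unique[x∷xs]⇒x∉xs (Unique-resp-↭ (++-comm mid [ _ ]) u) w∈

  data Chordless (R : A → A → Set) : List A → Set where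
    []  : Chordless R []
    [-] : ∀ {x} → Chordless R (x ∷ [])
    _∷_ : ∀ {x y ys} → All (λ w → ¬ R x w) ys → Chordless R (y ∷ ys) → Chordless R (x ∷ y ∷ ys)

  module _ {R : A → A → Set} where

    Chordless-tail : ∀ {x xs} → Chordless R (x ∷ xs) → Chordless R xs
    Chordless-tail [-]     = []
    Chordless-tail (_ ∷ c) = c

    Linked⇒related : ∀ xs {p q ys} → Linked R (xs ++ p ∷ q ∷ ys) → R p q
    Linked⇒related []       (r ∷ _) = r
    Linked⇒related (_ ∷ xs) l       = Linked⇒related xs (Linked.tail l)

    Linked-fromConsecutive : ∀ {l} → (∀ xs {p q} ys → l ≡ xs ++ p ∷ q ∷ ys → R p q) → Linked R l
    Linked-fromConsecutive {[]}         _ = []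
    Linked-fromConsecutive {_ ∷ []}     _ = [-]
    Linked-fromConsecutive {x ∷ _ ∷ _} f =
      f [] _ refl ∷ Linked-fromConsecutive (λ xs ys eq → f (x ∷ xs) ys (cong (x ∷_) eq))

    Linked-reverseAcc : Symmetric R → ∀ {x acc xs} → Linked R (x ∷ acc) → Linked R (x ∷ xs) →
                        Linked R (reverseAcc (x ∷ acc) xs)
    Linked-reverseAcc R-sym lacc [-]     = lacc
    Linked-reverseAcc R-sym lacc (r ∷ l) = Linked-reverseAcc R-sym (R-sym r ∷ lacc) l

    Linked-reverse : Symmetric R → ∀ {xs} → Linked R xs → Linked R (reverse xs)
    Linked-reverse R-sym []        = []
    Linked-reverse R-sym l@[-]     = l
    Linked-reverse R-sym l@(_ ∷ _) = Linked-reverseAcc R-sym [-] l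

    module _ (R? : Decidable R) {b : A} where

      -- q ∷ʳ b is the suffix of ys ∷ʳ b starting at the last element related to x.
      cutToLastRelated : ∀ x ys → Linked R (ys ∷ʳ b) → Chordless R (ys ∷ʳ b) →
        (∃ λ q → q ∷ʳ b ⊆ ys ∷ʳ b × Linked R (x ∷ q ∷ʳ b) × Chordless R (x ∷ q ∷ʳ b))
        ⊎ All (λ w → ¬ R x w) (ys ∷ʳ b)
      cutToLastRelated x [] l c with R? x b
      ... | yes r = inj₁ ([] , ⊆-refl , r ∷ l , [] ∷ c)
      ... | no ¬r = inj₂ (¬r ∷ [])
      cutToLastRelated x (y ∷ ys) l c with cutToLastRelated x ys (Linked.tail l) (Chordless-tail c)
      ... | inj₁ (q , sub , lq , cq) = inj₁ (q , y ∷ʳ⊆ sub , lq , cq)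
      ... | inj₂ none with R? x y
      ...   | yes r = inj₁ (y ∷ ys , ⊆-refl , r ∷ l , none ∷ c)
      ...   | no ¬r = inj₂ (¬r ∷ none)

      shortcut : ∀ x t → Linked R (x ∷ t ∷ʳ b) →
        ∃ λ q → q ∷ʳ b ⊆ t ∷ʳ b × Linked R (x ∷ q ∷ʳ b) × Chordless R (x ∷ q ∷ʳ b)
      shortcut x []      l = [] , ⊆-refl , l , [] ∷ [-]
      shortcut x (y ∷ t) (r ∷ l) with shortcut y t l
      ... | q , sub , lq , cq with cutToLastRelated x (y ∷ q) lq cq
      ...   | inj₁ (q′ , sub′ , lq′ , cq′) = q′ , ⊆-trans sub′ (refl ∷ sub) , lq′ , cq′
      ...   | inj₂ (¬r ∷ _)               = ⊥-elim (¬r r)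

module _ {n : ℕ} (G : Graph n) where

  private
    E-sym : Symmetric (E G)
    E-sym = Graph.sym G _ _

    E-irrefl : ∀ {x} → ¬ E G x x
    E-irrefl = Graph.irrefl G _

    E? : Decidable (E G)
    E? x y = T? (Graph.adj G x y)

  Consecutive-∷ : ∀ {h l x y} → Consecutive G l x y → Consecutive G (h ∷ l) x y
  Consecutive-∷ {h} (xs , ys , eq) = h ∷ xs , ys , cong (h ∷_) eq

  Consecutive⇒∈ : ∀ {c x y} → Consecutive G c x y → x ∈ c × y ∈ c
  Consecutive⇒∈ (xs , _ , refl) = ∈-++⁺ʳ xs (here refl) , ∈-++⁺ʳ xs (there (here refl))

  CycleAdj-sym : ∀ {c x y} → CycleAdj G c x y → CycleAdj G c y x
  CycleAdj-sym (inj₁ a)               = inj₂ (inj₁ a)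
  CycleAdj-sym (inj₂ (inj₁ a))        = inj₁ a
  CycleAdj-sym (inj₂ (inj₂ (inj₁ a))) = inj₂ (inj₂ (inj₂ a))
  CycleAdj-sym (inj₂ (inj₂ (inj₂ a))) = inj₂ (inj₂ (inj₁ a))

  Consecutive-rotate₁ : ∀ {x l p q} → Consecutive G (x ∷ l) p q →
                        Consecutive G (l ∷ʳ x) p q ⊎ (∃ λ mid → l ∷ʳ x ≡ q ∷ mid ∷ʳ p)
  Consecutive-rotate₁ ([] , ys , refl) = inj₂ (ys , refl)
  Consecutive-rotate₁ {p = p} {q} (h ∷ xs , ys , refl) =
    inj₁ (xs , ys ∷ʳ h , ++-assoc xs (p ∷ q ∷ ys) [ h ])

  closing-rotate₁ : ∀ {x l p q} → (∃ λ mid → x ∷ l ≡ p ∷ mid ∷ʳ q) → Consecutive G (l ∷ʳ x) q p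
  closing-rotate₁ {p = p} {q} (mid , refl) = mid , [] , ++-assoc mid [ q ] [ p ]

  CycleAdj-rotate₁ : ∀ {p q x l} → CycleAdj G (x ∷ l) p q → CycleAdj G (l ∷ʳ x) p q
  CycleAdj-rotate₁ (inj₁ a) with Consecutive-rotate₁ a
  ... | inj₁ a′ = inj₁ a′
  ... | inj₂ cl = inj₂ (inj₂ (inj₂ cl))
  CycleAdj-rotate₁ (inj₂ (inj₁ a)) with Consecutive-rotate₁ a
  ... | inj₁ a′ = inj₂ (inj₁ a′)
  ... | inj₂ cl = inj₂ (inj₂ (inj₁ cl))
  CycleAdj-rotate₁ (inj₂ (inj₂ (inj₁ cl))) = inj₂ (inj₁ (closing-rotate₁ cl))
  CycleAdj-rotate₁ (inj₂ (inj₂ (inj₂ cl))) = inj₁ (closing-rotate₁ cl)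

  CycleAdj-rotate : ∀ xs {ys p q} → CycleAdj G (xs ++ ys) p q → CycleAdj G (ys ++ xs) p q
  CycleAdj-rotate xs {p = p} {q} = rotate-++ (λ c → CycleAdj G c p q) CycleAdj-rotate₁ xs

  InducedCycle-rotate : ∀ xs {ys} → InducedCycle G (xs ++ ys) → InducedCycle G (ys ++ xs)
  InducedCycle-rotate xs {ys} ic = record
    { atLeast3 = rotate-++ AtLeastThree AtLeastThree-rotate xs atLeast3
    ; distinct = Unique-resp-↭ (++-comm xs ys) distinct
    ; cycEdges = λ p q p∈ q∈ pq → cycEdges p q (back p∈) (back q∈) (CycleAdj-rotate ys pq)
    ; induced  = λ p q p∈ q∈ e → CycleAdj-rotate xs (induced p q (back p∈) (back q∈) e)
    }
    where
    open InducedCycle ic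
    back : ∀ {p} → p ∈ ys ++ xs → p ∈ xs ++ ys
    back = ∈-resp-↭ (++-comm ys xs)

  Chordless⇒consecutive : ∀ {l x y} → Chordless (E G) l → x ∈ l → y ∈ l → E G x y →
                          Consecutive G l x y ⊎ Consecutive G l y x
  Chordless⇒consecutive [-]     (here refl) (here refl) e = ⊥-elim (E-irrefl e)
  Chordless⇒consecutive (_ ∷ _) (here refl) (here refl) e = ⊥-elim (E-irrefl e)
  Chordless⇒consecutive (_ ∷ _) (here refl) (there (here refl)) _ = inj₁ ([] , _ , refl)
  Chordless⇒consecutive (_ ∷ _) (there (here refl)) (here refl) _ = inj₂ ([] , _ , refl)
  Chordless⇒consecutive (none ∷ _) (here refl) (there (there y∈)) e = ⊥-elim (All.lookup none y∈ e)
  Chordless⇒consecutive (none ∷ _) (there (there x∈)) (here refl) e = ⊥-elim (All.lookup none x∈ (E-sym e))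
  Chordless⇒consecutive (_ ∷ c) (there x∈) (there y∈) e with Chordless⇒consecutive c x∈ y∈ e
  ... | inj₁ a = inj₁ (Consecutive-∷ a)
  ... | inj₂ a = inj₂ (Consecutive-∷ a)

  CycleAdj⇒E : ∀ {x m y p q} → Linked (E G) (x ∷ m ∷ʳ y) → E G x y →
               CycleAdj G (x ∷ m ∷ʳ y) p q → E G p q
  CycleAdj⇒E linked xy (inj₁ (xs , _ , eq))        = Linked⇒related xs (subst (Linked (E G)) eq linked)
  CycleAdj⇒E linked xy (inj₂ (inj₁ (xs , _ , eq))) = E-sym (Linked⇒related xs (subst (Linked (E G)) eq linked))
  CycleAdj⇒E linked xy (inj₂ (inj₂ (inj₁ cl)))      = closing xy cl
    where
    closing : ∀ {x m y p q} → E G x y → (∃ λ mid → x ∷ m ∷ʳ y ≡ p ∷ mid ∷ʳ q) → E G p q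
    closing {m = m} xy (mid , eq) with ∷-injective eq
    ... | refl , eq′ with ∷ʳ-injectiveʳ m mid eq′
    ... | refl = xy
  CycleAdj⇒E linked xy (inj₂ (inj₂ (inj₂ cl)))      = E-sym (CycleAdj⇒E linked xy (inj₂ (inj₂ (inj₁ cl))))

  apex-cycle : ∀ {u a b q} → let Q = a ∷ q ∷ʳ b in
    Unique (u ∷ Q) → Linked (E G) Q → Chordless (E G) Q → E G u a → E G u b →
    (∀ {y} → y ∈ Q → E G u y → y ≡ a ⊎ y ≡ b) →
    InducedCycle G (u ∷ Q) × P3InCycle G a u b (u ∷ Q)
  apex-cycle {u} {a} {b} {q} uniq linked chordless ua ub u-adj =
    cycle , there (here refl) , here refl , there (there (∈-++⁺ʳ q (here refl))) , CycleAdj-sym u~a , u~b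
    where
    C : List (Vertex G)
    C = u ∷ a ∷ q ∷ʳ b

    u~a : CycleAdj G C u a
    u~a = inj₁ ([] , q ∷ʳ b , refl)

    u~b : CycleAdj G C u b
    u~b = inj₂ (inj₂ (inj₁ (a ∷ q , refl)))

    from-u : ∀ {y} → y ∈ a ∷ q ∷ʳ b → E G u y → CycleAdj G C u y
    from-u y∈ e with u-adj y∈ e
    ... | inj₁ refl = u~a
    ... | inj₂ refl = u~b

    induced : ∀ x y → x ∈ C → y ∈ C → E G x y → CycleAdj G C x y
    induced _ _ (here refl) (here refl)  e = ⊥-elim (E-irrefl e)
    induced _ _ (here refl) (there y∈)   e = from-u y∈ e
    induced _ _ (there x∈)  (here refl)  e = CycleAdj-sym (from-u x∈ (E-sym e))
    induced _ _ (there x∈)  (there y∈)   e with Chordless⇒consecutive chordless x∈ y∈ e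
    ... | inj₁ a = inj₁ (Consecutive-∷ a)
    ... | inj₂ a = inj₂ (inj₁ (Consecutive-∷ a))

    atLeast3 : AtLeastThree C
    atLeast3 with ∷ʳ-nonempty q b
    ... | k , t , eq = u , a , k , t , cong (λ r → u ∷ a ∷ r) eq

    cycle : InducedCycle G C
    cycle = record
      { atLeast3 = atLeast3
      ; distinct = uniq
      ; cycEdges = λ _ _ _ _ → CycleAdj⇒E {m = a ∷ q} (ua ∷ linked) ub
      ; induced  = induced
      }

  protected⇒avoidable : ∀ u → (∀ x → N G u x → Protects G x u) → Avoidable G u
  protected⇒avoidable u prot a b (au , ub , a≢b , _) with prot a (E-sym au) b ub
  ... | inj₁ a≡b = ⊥-elim (a≢b a≡b)
  ... | inj₂ (mid , uniq , linked , avoids) with shortcut E? a mid linked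
  ... | q , sub , linked′ , chordless =
    u ∷ a ∷ q ∷ʳ b ,
    apex-cycle (All-resp-⊆ Q⊆P (¬Any⇒All¬ _ u∉P) ∷ Unique-resp-⊇ Q⊆P uniq)
               linked′ chordless (E-sym au) ub (λ y∈ → u-adj (lookup Q⊆P y∈))
    where
    Q⊆P : a ∷ q ∷ʳ b ⊆ a ∷ mid ∷ʳ b
    Q⊆P = refl ∷ sub

    on-path : ∀ {y} → y ∈ a ∷ mid ∷ʳ b → y ≡ a ⊎ y ≡ b ⊎ ¬ N[_] G u y
    on-path (here y≡a) = inj₁ y≡a
    on-path (there y∈) with ∈-∷ʳ⁻ mid y∈
    ... | inj₁ y∈mid = inj₂ (inj₂ (All.lookup avoids y∈mid))
    ... | inj₂ y≡b   = inj₂ (inj₁ y≡b)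

    u∉P : u ∉ a ∷ mid ∷ʳ b
    u∉P u∈ with on-path u∈
    ... | inj₁ u≡a        = E-irrefl (subst (E G u) (sym u≡a) (E-sym au))
    ... | inj₂ (inj₁ u≡b) = E-irrefl (subst (E G u) (sym u≡b) ub)
    ... | inj₂ (inj₂ ¬N)  = ¬N (inj₁ refl)

    u-adj : ∀ {y} → y ∈ a ∷ mid ∷ʳ b → E G u y → y ≡ a ⊎ y ≡ b
    u-adj y∈ e with on-path y∈
    ... | inj₁ y≡a        = inj₁ y≡a
    ... | inj₂ (inj₁ y≡b) = inj₂ y≡b
    ... | inj₂ (inj₂ ¬N)  = ⊥-elim (¬N (inj₂ e))

  ExcludedPath-sym : ∀ {S x z} → ExcludedPath G S z x → ExcludedPath G S x z
  ExcludedPath-sym (inj₁ refl) = inj₁ refl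
  ExcludedPath-sym {x = x} {z} (inj₂ (mid , uniq , linked , avoids)) =
    inj₂ ( reverse mid
         , subst Unique rev (Unique-resp-↭ (↭-sym (↭-reverse _)) uniq)
         , subst (Linked (E G)) rev (Linked-reverse E-sym linked)
         , All-resp-↭ (↭-sym (↭-reverse mid)) avoids )
    where
    rev : reverse (z ∷ mid ∷ʳ x) ≡ x ∷ reverse mid ∷ʳ z
    rev = reverse-∷-∷ʳ z mid x

  InducedCycle-tail-linked : ∀ {u L} → InducedCycle G (u ∷ L) → Linked (E G) L
  InducedCycle-tail-linked ic = Linked-fromConsecutive λ xs ys eq → edge (Consecutive-∷ (xs , ys , eq))
    where
    open InducedCycle ic
    edge : ∀ {p q} → Consecutive G _ p q → E G p q
    edge pq = cycEdges _ _ (proj₁ (Consecutive⇒∈ pq)) (proj₂ (Consecutive⇒∈ pq)) (inj₁ pq)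

  -- The four other ways of being cycle-adjacent to u would put a second copy of u into L.
  neighbour-EndOf : ∀ {u L w} → Unique (u ∷ L) → CycleAdj G (u ∷ L) u w → EndOf L w
  neighbour-EndOf _ (inj₁ ([] , ys , refl))                 = inj₁ (ys , refl)
  neighbour-EndOf _ (inj₂ (inj₂ (inj₁ (mid , refl))))       = inj₂ (mid , refl)
  neighbour-EndOf uniq (inj₁ (_ ∷ xs , _ , refl))          = ⊥-elim (Unique[x∷xs]⇒x∉xs uniq (∈-++⁺ʳ xs (here refl)))
  neighbour-EndOf uniq (inj₂ (inj₁ ([] , _ , refl)))        = ⊥-elim (Unique[x∷xs]⇒x∉xs uniq (here refl))
  neighbour-EndOf uniq (inj₂ (inj₁ (_ ∷ xs , _ , refl)))    = ⊥-elim (Unique[x∷xs]⇒x∉xs uniq (∈-++⁺ʳ xs (there (here refl))))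
  neighbour-EndOf uniq (inj₂ (inj₂ (inj₂ (mid , refl))))    = ⊥-elim (Unique[x∷xs]⇒x∉xs uniq (∈-++⁺ʳ mid (here refl)))

  path-along-cycle : ∀ {u x mid z} → InducedCycle G (u ∷ x ∷ mid ∷ʳ z) → ExcludedPath G (N[_] G u) x z
  path-along-cycle {u} {x} {mid} {z} ic = inj₂ (mid , uniq , InducedCycle-tail-linked ic , All.tabulate interior)
    where
    open InducedCycle ic
    uniq : Unique (x ∷ mid ∷ʳ z)
    uniq = UniqueList.tail distinct

    interior : ∀ {w} → w ∈ mid → ¬ N[_] G u w
    interior w∈ (inj₁ refl) = Unique[x∷xs]⇒x∉xs distinct (there (∈-++⁺ˡ w∈))
    interior w∈ (inj₂ e)    =
      EndOf-∉-interior uniq (neighbour-EndOf distinct (induced _ _ (here refl) (there (there (∈-++⁺ˡ w∈))) e)) w∈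

  path-around-cycle : ∀ {u L x z} → InducedCycle G (u ∷ L) → CycleAdj G (u ∷ L) x u →
                      CycleAdj G (u ∷ L) u z → x ≢ z → ExcludedPath G (N[_] G u) x z
  path-around-cycle {u} {L} ic xu uz x≢z with EndOf-distinct (end (CycleAdj-sym xu)) (end uz) x≢z
    where
    end : ∀ {w} → CycleAdj G (u ∷ L) u w → EndOf L w
    end = neighbour-EndOf (InducedCycle.distinct ic)
  ... | inj₁ (_ , refl) = path-along-cycle ic
  ... | inj₂ (_ , refl) = ExcludedPath-sym (path-along-cycle ic)

  avoidable⇒protected : ∀ u → Avoidable G u → ∀ x → N G u x → Protects G x u
  avoidable⇒protected u av x ux z uz with x ≟ z | E? x z
  ... | yes refl | _      = inj₁ refl
  ... | no x≢z   | yes xz = inj₂ ([] , (x≢z ∷ []) ∷ [] ∷ [] , xz ∷ [-] , [])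
  ... | no x≢z   | no ¬xz with av x z (E-sym ux , uz , x≢z , ¬xz)
  ... | c , ic , _ , u∈c , _ , xu , uz′ with ∈-∃++ u∈c
  ... | A , B , refl =
    path-around-cycle (InducedCycle-rotate A ic) (CycleAdj-rotate A xu) (CycleAdj-rotate A uz′) x≢z

lemma20 : ∀ {n : ℕ} (G : Graph n) (u : Vertex G) →
    Avoidable G u ⇔ (∀ x → N G u x → Protects G x u)
lemma20 G u = mk⇔ (avoidable⇒protected G u) (protected⇒avoidable G u)
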